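{- Let $\ell\ge2$, let $\Psi\subseteq\Delta^+_\ell$ be a root ideal, $M$ a multiset on $\{1,\dots,\ell\}$, and $\gamma\in\mathbb Z^\ell$. Let $p\to q$ be a bounce edge of $\Psi$ such that: (a) $\beta:=(q,p-1)$ is an addable root of $\Psi$; (b) $\gamma_p=\gamma_{p-1}+1$; (c) $m_M(p)=m_M(p-1)+1$; (d) $\Psi$ has a wall in rows $p-1,p$. Then $$K(\Psi;M;\gamma)=K(\Psi\cup\{\beta\};M;\gamma+\epsilon_q-\epsilon_p)=K(\Psi\cup\{\beta\};M\sqcup\{p-1\};\gamma+\epsilon_q-\epsilon_p).$$
   Context: $\epsilon_i$ is the standard basis of $\mathbb Z^\ell$, and $\Delta^+_\ell=\{(i,j):1\le i<j\le\ell\}$ with $(i,j)\leftrightarrow\epsilon_i-\epsilon_j$. A root ideal is $\Psi\subseteq\Delta^+_\ell$ with $(i,j)\in\Psi$ and $i'\le i<j\le j'$ implying $(i',j')\in\Psi$. A root $\alpha\in\Psi$ is removable if $\Psi\setminus\{\alpha\}$ is a root ideal. A root $\beta\in\Delta^+_\ell\setminus\Psi$ is addable if $\Psi\cup\{\beta\}$ is a root ideal. A bounce edge $p\to q$ of $\Psi$ means that $(q,p)$ is a removable root of $\Psi$. Row $r$ of $\Psi$ is $\{(r,j)\in\Psi\}$, and $\Psi$ has a wall in rows $p-1,p$ if these two rows have the same number of elements. $m_M$ is the multiplicity function of $M$, and $M\sqcup\{p-1\}$ increases the multiplicity of $p-1$ by one. $h_r$ are the complete homogeneous symmetric functions ($h_0=1$,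 $h_r=0$ for $r<0$), $h^{(m)}_i=\sum_{j=0}^i\binom{m+j-1}{j}h_{i-j}$, and $k_\gamma=h^{(0)}_{\gamma_1}\cdots h^{(\ell-1)}_{\gamma_\ell}$. The Katalan function is $$K(\Psi;M;\gamma)=\sum_{S\subseteq\Delta^+_\ell\setminus\Psi}\sum_{0\le a_j\le m_M(j)}(-1)^{|S|+\sum a_j}\prod_j\binom{m_M(j)}{a_j}k_{\gamma+\sum_{(i,j)\in S}(\epsilon_i-\epsilon_j)-\sum a_j\epsilon_j}.$$ -}

module Defs where

open import Level using (Level)
open import Data.Bool using (Bool; true; false; _∧_; not; if_then_else_)
open import Data.Nat as ℕ using (ℕ; zero; suc; _∸_)
open import Data.Nat.Combinatorics using (_C_)
open import Data.Integer as ℤ using (ℤ; +_; -[1+_])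
open import Data.Fin as Fin using (Fin; toℕ)
open import Data.Fin.Properties using (_≟_)
open import Data.List using (List; []; _∷_; [_]; _++_; map; concatMap; foldr; length; allFin; upTo)
open import Data.Product using (_×_; _,_; proj₁; proj₂)
open import Relation.Nullary using (does)
open import Relation.Binary.PropositionalEquality using (_≡_)
open import Algebra.Bundles using (CommutativeRing)

-- Positive roots and root ideals.  Indices 1..ℓ of the paper are
-- represented by Fin ℓ (0-based); (i , j) stands for ε_i - ε_j.

Root : ℕ → Set
Root ℓ = Fin ℓ × Fin ℓ

RootSet : ℕ → Set
RootSet ℓ = Fin ℓ → Fin ℓ → Bool

_∈R_ : ∀ {ℓ} → Root ℓ → RootSet ℓ → Set
(i , j) ∈R Ψ = Ψ i j ≡ true

_∉R_ : ∀ {ℓ} → Root ℓ → RootSet ℓ → Set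
(i , j) ∉R Ψ = Ψ i j ≡ false

IsPosRoot : ∀ {ℓ} → Root ℓ → Set
IsPosRoot (i , j) = i Fin.< j

record IsRootIdeal {ℓ} (Ψ : RootSet ℓ) : Set where
  field
    ⊆Δ⁺   : ∀ i j → (i , j) ∈R Ψ → i Fin.< j
    upper : ∀ i j i′ j′ → (i , j) ∈R Ψ → i′ Fin.≤ i → j Fin.≤ j′ → (i′ , j′) ∈R Ψ

eqR : ∀ {ℓ} → Root ℓ → Root ℓ → Bool
eqR (i , j) (a , b) = does (i ≟ a) ∧ does (j ≟ b)

removeR : ∀ {ℓ} → RootSet ℓ → Root ℓ → RootSet ℓ
removeR Ψ α i j = Ψ i j ∧ not (eqR (i , j) α)

insertR : ∀ {ℓ} → RootSet ℓ → Root ℓ → RootSet ℓ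
insertR Ψ β i j = if eqR (i , j) β then true else Ψ i j

Removable : ∀ {ℓ} → RootSet ℓ → Root ℓ → Set
Removable Ψ α = α ∈R Ψ × IsRootIdeal (removeR Ψ α)

Addable : ∀ {ℓ} → RootSet ℓ → Root ℓ → Set
Addable Ψ β = IsPosRoot β × β ∉R Ψ × IsRootIdeal (insertR Ψ β)

BounceEdge : ∀ {ℓ} → RootSet ℓ → Fin ℓ → Fin ℓ → Set
BounceEdge Ψ p q = Removable Ψ (q , p)

rowLength : ∀ {ℓ} → RootSet ℓ → Fin ℓ → ℕ
rowLength {ℓ} Ψ r = length (concatMap (λ j → if Ψ r j then [ j ] else []) (allFin ℓ))

Wall : ∀ {ℓ} → RootSet ℓ → Fin ℓ → Fin ℓ → Set
Wall Ψ r r′ = rowLength Ψ r ≡ rowLength Ψ r′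

complementRoots : ∀ {ℓ} → RootSet ℓ → List (Root ℓ)
complementRoots {ℓ} Ψ =
  concatMap (λ i → concatMap (λ j →
      if does (i Fin.<? j) ∧ not (Ψ i j) then [ (i , j) ] else [])
    (allFin ℓ)) (allFin ℓ)

-- all sublists (= all subsets of a duplicate-free list)
subsets : ∀ {A : Set} → List A → List (List A)
subsets []       = [ [] ]
subsets (x ∷ xs) = subsets xs ++ map (x ∷_) (subsets xs)

Multiset : ℕ → Set
Multiset ℓ = Fin ℓ → ℕ

addElem : ∀ {ℓ} → Multiset ℓ → Fin ℓ → Multiset ℓ
addElem M r k = if does (k ≟ r) then suc (M k) else M k

shiftAt : ∀ {ℓ} → (Fin ℓ → ℤ) → Fin ℓ → ℤ → (Fin ℓ → ℤ)
shiftAt γ r d k = if does (k ≟ r) then γ k ℤ.+ d else γ k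

addRoot : ∀ {ℓ} → (Fin ℓ → ℤ) → Root ℓ → (Fin ℓ → ℤ)
addRoot γ (i , j) = shiftAt (shiftAt γ i (+ 1)) j (ℤ.- (+ 1))

boxes : ∀ {ℓ} → (Fin ℓ → ℕ) → List (Fin ℓ → ℕ)
boxes {zero}  m = [ (λ ()) ]
boxes {suc n} m =
  concatMap (λ a₀ → map (λ rest → cons a₀ rest) (boxes (λ k → m (Fin.suc k))))
            (upTo (suc (m Fin.zero)))
  where
  cons : ℕ → (Fin n → ℕ) → Fin (suc n) → ℕ
  cons a rest Fin.zero    = a
  cons a rest (Fin.suc k) = rest k

sumFin : ∀ {ℓ} → (Fin ℓ → ℕ) → ℕ
sumFin {zero}  f = 0
sumFin {suc n} f = f Fin.zero ℕ.+ sumFin (λ k → f (Fin.suc k))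

prodFinℕ : ∀ {ℓ} → (Fin ℓ → ℕ) → ℕ
prodFinℕ {zero}  f = 1
prodFinℕ {suc n} f = f Fin.zero ℕ.* prodFinℕ (λ k → f (Fin.suc k))

-- Katalan functions, valued in an arbitrary commutative ring R with an
-- arbitrary choice of elements h 0 , h 1 , … ; here  h r  plays the
-- role of h_{r+1}.  (Λ is the free commutative ring on h_1, h_2, …, so
-- an identity of Katalan functions in Λ is the same as the identity for
-- all such (R , h).)

module Katalan {c ℓr : Level} (R : CommutativeRing c ℓr)
               (h : ℕ → CommutativeRing.Carrier R) where
  open CommutativeRing R

  natR : ℕ → Carrier
  natR zero    = 0#
  natR (suc n) = 1# + natR n

  sign : ℕ → Carrier
  sign zero    = 1#
  sign (suc n) = - (sign n)

  sumR : List Carrier → Carrier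
  sumR = foldr _+_ 0#

  hℕ : ℕ → Carrier
  hℕ zero    = 1#
  hℕ (suc r) = h r

  -- h^{(m)}_n = Σ_{j=0}^n binom(m+j-1, j) h_{n-j}   for n ≥ 0
  -- (binom(m+j-1,j) written (m + j ∸ 1) C j; for m = 0 this gives
  --  1 at j = 0 and 0 for j > 0, matching binom(j-1,j))
  hmℕ : ℕ → ℕ → Carrier
  hmℕ m n = sumR (map (λ j → natR ((m ℕ.+ j ∸ 1) C j) * hℕ (n ∸ j)) (upTo (suc n)))

  -- h^{(m)}_i for i ∈ ℤ (empty sum = 0 for i < 0)
  hm : ℕ → ℤ → Carrier
  hm m (+ n)    = hmℕ m n
  hm m -[1+ n ] = 0#

  prodFin : ∀ {ℓ} → (Fin ℓ → Carrier) → Carrier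
  prodFin {zero}  f = 1#
  prodFin {suc n} f = f Fin.zero * prodFin (λ k → f (Fin.suc k))

  kfun : ∀ {ℓ} → (Fin ℓ → ℤ) → Carrier
  kfun γ = prodFin (λ i → hm (toℕ i) (γ i))

  exponent : ∀ {ℓ} → (Fin ℓ → ℤ) → List (Root ℓ) → (Fin ℓ → ℕ) → (Fin ℓ → ℤ)
  exponent γ S a k = foldr (λ α g → addRoot g α) γ S k ℤ.- (+ a k)

  K : ∀ {ℓ} → RootSet ℓ → Multiset ℓ → (Fin ℓ → ℤ) → Carrier
  K Ψ M γ =
    sumR (map (λ S → sumR (map (λ a →
        sign (length S ℕ.+ sumFin a)
          * natR (prodFinℕ (λ j → M j C a j))
          * kfun (exponent γ S a))
      (boxes M)))
    (subsets (complementRoots Ψ)))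

-- Write G_M(v) = ∏_i (1 - L)^{m_M(i)} h^{(i-1)}_{v_i}, where L lowers the index by one. Then
-- K(Ψ;M;γ) = Φ_{Δ⁺∖Ψ}(γ) with Φ_L(γ) = Σ_{S ⊆ L} (-1)^{|S|} G_M(γ + Σ_{α∈S} α), and
-- Φ_{α∷L}(γ) = Φ_L(γ) - Φ_L(γ + α). Since (1 - L) h^{(s+1)} = h^{(s)} and m_M(p) = m_M(p-1) + 1, the
-- factors of G_M at p-1 and p coincide, so G_M is invariant under the transposition τ of p-1 and p.
-- The wall and the bounce edge make Ψ′ = Ψ ∪ {β} τ-symmetric, so Δ⁺∖Ψ′ = {(p-1,p)} ∪ C with C
-- τ-stable; hence Φ_{Δ⁺∖Ψ′}(v) = Φ_C(v) - Φ_C(v + ε_{p-1} - ε_p) vanishes whenever v_p = v_{p-1} + 1,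
-- for then v + ε_{p-1} - ε_p = v ∘ τ. Expanding K(Ψ;M;γ) along β leaves Φ_{Δ⁺∖Ψ′}(γ) = 0 and
-- -Φ_{Δ⁺∖Ψ′}(γ + β), which the τ-symmetry of Φ_C turns into Φ_{Δ⁺∖Ψ′}(γ + ε_q - ε_p). For the second
-- identity, adding p-1 to M multiplies G_M by 1 - L_{p-1}, and the subtracted term is Φ_{Δ⁺∖Ψ′} at a
-- vector that again satisfies v_p = v_{p-1} + 1.

module Submission where

open import Defs
open import Level using (Level)
open import Data.Nat.Combinatorics using (_C_; nCk+nC[k+1]≡[n+1]C[k+1]; k>n⇒nCk≡0)
open import Data.Bool using (Bool; true; false; not; _∧_; if_then_else_)
open import Data.Bool.Properties using (not-¬; ∧-zeroʳ; ∧-identityʳ)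
open import Data.Nat as ℕ using (ℕ; zero; suc; _∸_; _≤_; z≤n; s≤s)
import Data.Nat.Properties as ℕ
open import Data.Integer as ℤ using (ℤ; +_; -[1+_]; 1ℤ; -1ℤ) renaming (_+_ to _+ℤ_)
import Data.Integer.Properties as ℤ
open import Data.Fin as Fin using (Fin; toℕ)
import Data.Fin.Properties as Fin
open import Data.Fin.Properties using (_≟_)
import Data.Fin.Permutation.Components as PC
import Data.Fin.Permutation as Perm
import Algebra.Properties.CommutativeMonoid.Sum
open import Data.List
  using (List; []; _∷_; [_]; _++_; map; concatMap; foldr; length; allFin; filter; upTo; applyUpTo)
open import Data.List.Properties using (map-++; map-∘)
open import Data.Product using (Σ; _×_; _,_; proj₁; proj₂)
open import Data.Product.Properties using (≡-dec)
open import Data.Sum using (_⊎_; inj₁; inj₂)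
open import Data.Empty using (⊥-elim)
open import Function using (_∘_; _⇔_; mk⇔)
open import Relation.Nullary using (¬_; Dec; yes; no; does)
open import Relation.Nullary.Decidable using (dec-true; ¬?)
open import Relation.Binary.PropositionalEquality
  using (_≡_; _≢_; _≗_; refl; sym; trans; cong; cong₂; subst; subst₂; module ≡-Reasoning)
open import Data.List.Membership.Propositional using (_∈_; _∉_; lose; find)
open import Data.List.Membership.Propositional.Properties
  using (∈-concatMap⁺; ∈-concatMap⁻; ∈-allFin; ∈-filter⁺; ∈-filter⁻; ∈-map⁺; ∈-map⁻)
open import Data.List.Membership.Propositional.Properties.WithK using (unique∧set⇒bag)
open import Data.List.Relation.Unary.Any using (here; there)
open import Data.List.Relation.Unary.All.Properties using (¬Any⇒All¬)
open import Data.List.Relation.Unary.All using ([])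
open import Data.List.Relation.Unary.AllPairs using ([]; _∷_)
open import Data.List.Relation.Unary.Unique.Propositional using (Unique)
import Data.List.Relation.Unary.Unique.Propositional.Properties as Unique
open import Data.List.Relation.Binary.Permutation.Propositional using (_↭_; module _↭_)
open import Data.List.Relation.Binary.BagAndSetEquality using (∼bag⇒↭)
open import Algebra.Bundles using (CommutativeRing)

agree-at-pair⇒≗ : ∀ {ℓ} {A : Set} {u v : Fin ℓ → A} (i j : Fin ℓ) →
  u i ≡ v i → u j ≡ v j → (∀ k → k ≢ i → k ≢ j → u k ≡ v k) → u ≗ v
agree-at-pair⇒≗ i j ui uj uk k with k ≟ i | k ≟ j
... | yes refl | _        = ui
... | no _     | yes refl = uj
... | no k≢i   | no k≢j   = uk k k≢i k≢j

i+1-1≡i : ∀ i → i +ℤ 1ℤ +ℤ -1ℤ ≡ i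
i+1-1≡i i = trans (ℤ.+-assoc i 1ℤ -1ℤ) (ℤ.+-identityʳ i)

i-1+1≡i : ∀ i → i +ℤ -1ℤ +ℤ 1ℤ ≡ i
i-1+1≡i i = trans (ℤ.+-assoc i -1ℤ 1ℤ) (ℤ.+-identityʳ i)

module _ {ℓ : ℕ} where

  lowerAt : (Fin ℓ → ℤ) → Fin ℓ → (Fin ℓ → ℤ)
  lowerAt v r = shiftAt v r -1ℤ

  addRoots : (Fin ℓ → ℤ) → List (Root ℓ) → (Fin ℓ → ℤ)
  addRoots γ S = foldr (λ α g → addRoot g α) γ S

  shiftAt-self : ∀ (v : Fin ℓ → ℤ) r d → shiftAt v r d r ≡ v r +ℤ d
  shiftAt-self v r d rewrite dec-true (r ≟ r) refl = refl

  shiftAt-other : ∀ (v : Fin ℓ → ℤ) {r} d {k} → k ≢ r → shiftAt v r d k ≡ v k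
  shiftAt-other v {r} d {k} k≢r with k ≟ r
  ... | yes k≡r = ⊥-elim (k≢r k≡r)
  ... | no _    = refl

  addElem-self : ∀ (M : Multiset ℓ) r → addElem M r r ≡ suc (M r)
  addElem-self M r rewrite dec-true (r ≟ r) refl = refl

  addElem-other : ∀ (M : Multiset ℓ) {r k} → k ≢ r → addElem M r k ≡ M k
  addElem-other M {r} {k} k≢r with k ≟ r
  ... | yes k≡r = ⊥-elim (k≢r k≡r)
  ... | no _    = refl

  shiftAt-cong : ∀ {u v : Fin ℓ → ℤ} r d → u ≗ v → shiftAt u r d ≗ shiftAt v r d
  shiftAt-cong r d u≗v k with does (k ≟ r)
  ... | true  = cong (_+ℤ d) (u≗v k)
  ... | false = u≗v k

  shiftAt-comm : ∀ (v : Fin ℓ → ℤ) r d r′ d′ →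
    shiftAt (shiftAt v r d) r′ d′ ≗ shiftAt (shiftAt v r′ d′) r d
  shiftAt-comm v r d r′ d′ k with does (k ≟ r) | does (k ≟ r′)
  ... | true  | true  = trans (ℤ.+-assoc (v k) d d′)
                        (trans (cong (v k +ℤ_) (ℤ.+-comm d d′)) (sym (ℤ.+-assoc (v k) d′ d)))
  ... | true  | false = refl
  ... | false | true  = refl
  ... | false | false = refl

  addRoot-source : ∀ (v : Fin ℓ → ℤ) {i j} → i ≢ j → addRoot v (i , j) i ≡ v i +ℤ 1ℤ
  addRoot-source v {i} i≢j = trans (shiftAt-other (shiftAt v i 1ℤ) -1ℤ i≢j) (shiftAt-self v i 1ℤ)

  addRoot-target : ∀ (v : Fin ℓ → ℤ) {i j} → i ≢ j → addRoot v (i , j) j ≡ v j +ℤ -1ℤ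
  addRoot-target v {i} {j} i≢j =
    trans (shiftAt-self (shiftAt v i 1ℤ) j -1ℤ) (cong (_+ℤ -1ℤ) (shiftAt-other v 1ℤ (i≢j ∘ sym)))

  addRoot-off-target : ∀ (v : Fin ℓ → ℤ) {i j k} → k ≢ j → addRoot v (i , j) k ≡ shiftAt v i 1ℤ k
  addRoot-off-target v {i} k≢j = shiftAt-other (shiftAt v i 1ℤ) -1ℤ k≢j

  addRoot-other : ∀ (v : Fin ℓ → ℤ) {i j k} → k ≢ i → k ≢ j → addRoot v (i , j) k ≡ v k
  addRoot-other v k≢i k≢j = trans (addRoot-off-target v k≢j) (shiftAt-other v 1ℤ k≢i)

  addRoot-cong : ∀ {u v : Fin ℓ → ℤ} α → u ≗ v → addRoot u α ≗ addRoot v α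
  addRoot-cong (i , j) u≗v = shiftAt-cong j _ (shiftAt-cong i _ u≗v)

  shiftAt-addRoot : ∀ (v : Fin ℓ → ℤ) r d α → shiftAt (addRoot v α) r d ≗ addRoot (shiftAt v r d) α
  shiftAt-addRoot v r d (i , j) k =
    trans (shiftAt-comm (shiftAt v i 1ℤ) j -1ℤ r d k) (shiftAt-cong j _ (shiftAt-comm v i 1ℤ r d) k)

  addRoot-comm : ∀ (v : Fin ℓ → ℤ) α β → addRoot (addRoot v α) β ≗ addRoot (addRoot v β) α
  addRoot-comm v α (a , b) k =
    trans (shiftAt-cong b _ (shiftAt-addRoot v a 1ℤ α) k) (shiftAt-addRoot (shiftAt v a 1ℤ) b -1ℤ α k)

  addRoots-shiftAt : ∀ (v : Fin ℓ → ℤ) r d S → shiftAt (addRoots v S) r d ≗ addRoots (shiftAt v r d) S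
  addRoots-shiftAt v r d []      k = refl
  addRoots-shiftAt v r d (β ∷ S) k =
    trans (shiftAt-addRoot (addRoots v S) r d β k) (addRoot-cong β (addRoots-shiftAt v r d S) k)

  addRoots-cong : ∀ {u v : Fin ℓ → ℤ} S → u ≗ v → addRoots u S ≗ addRoots v S
  addRoots-cong []      u≗v = u≗v
  addRoots-cong (α ∷ S) u≗v = addRoot-cong α (addRoots-cong S u≗v)

  addRoot-addRoots : ∀ (v : Fin ℓ → ℤ) α S → addRoot (addRoots v S) α ≗ addRoots (addRoot v α) S
  addRoot-addRoots v α []      k = refl
  addRoot-addRoots v α (β ∷ S) k =
    trans (addRoot-comm (addRoots v S) β α k) (addRoot-cong β (addRoot-addRoots v α S) k)

module Transposition {ℓ} (i j : Fin ℓ) where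

  τ : Fin ℓ → Fin ℓ
  τ = PC.transpose i j

  τ-i : τ i ≡ j
  τ-i rewrite dec-true (i ≟ i) refl = refl

  τ-j : τ j ≡ i
  τ-j with j ≟ i
  ... | yes refl = refl
  ... | no _ rewrite dec-true (j ≟ j) refl = refl

  τ-other : ∀ {k} → k ≢ i → k ≢ j → τ k ≡ k
  τ-other {k} k≢i k≢j with k ≟ i
  ... | yes k≡i = ⊥-elim (k≢i k≡i)
  ... | no _ with k ≟ j
  ...   | yes k≡j = ⊥-elim (k≢j k≡j)
  ...   | no _    = refl

  τ-involutive : ∀ k → τ (τ k) ≡ k
  τ-involutive k = by-cases (k ≟ i) (k ≟ j)
    where
    by-cases : Dec (k ≡ i) → Dec (k ≡ j) → τ (τ k) ≡ k
    by-cases (yes k≡i) _ = subst (λ x → τ (τ x) ≡ x) (sym k≡i) (trans (cong τ τ-i) τ-j)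
    by-cases (no _) (yes k≡j) = subst (λ x → τ (τ x) ≡ x) (sym k≡j) (trans (cong τ τ-j) τ-i)
    by-cases (no k≢i) (no k≢j) = trans (cong τ (τ-other k≢i k≢j)) (τ-other k≢i k≢j)

  ∘τ≗ : ∀ {A : Set} (f : Fin ℓ → A) → f i ≡ f j → f ∘ τ ≗ f
  ∘τ≗ f fi≡fj = agree-at-pair⇒≗ i j (trans (cong f τ-i) (sym fi≡fj)) (trans (cong f τ-j) fi≡fj)
    (λ k k≢i k≢j → cong f (τ-other k≢i k≢j))

  τRoot : Root ℓ → Root ℓ
  τRoot (a , b) = τ a , τ b

  τRoot-involutive : ∀ α → τRoot (τRoot α) ≡ α
  τRoot-involutive (a , b) = cong₂ _,_ (τ-involutive a) (τ-involutive b)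

  shiftAt-∘τ : ∀ (v : Fin ℓ → ℤ) r d → shiftAt (v ∘ τ) (τ r) d ≗ shiftAt v r d ∘ τ
  shiftAt-∘τ v r d k with k ≟ τ r | τ k ≟ r
  ... | yes _   | yes _   = refl
  ... | no _    | no _    = refl
  ... | yes k≡τr | no τk≢r = ⊥-elim (τk≢r (trans (cong τ k≡τr) (τ-involutive r)))
  ... | no k≢τr | yes τk≡r = ⊥-elim (k≢τr (trans (sym (τ-involutive k)) (cong τ τk≡r)))

  addRoot-∘τ : ∀ (v : Fin ℓ → ℤ) α → addRoot (v ∘ τ) (τRoot α) ≗ addRoot v α ∘ τ
  addRoot-∘τ v (a , b) k =
    trans (shiftAt-cong (τ b) -1ℤ (shiftAt-∘τ v a 1ℤ) k) (shiftAt-∘τ (shiftAt v a 1ℤ) b -1ℤ k)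

module StraighteningVectors {ℓ} {i j q : Fin ℓ} (i≢j : i ≢ j) (q≢i : q ≢ i) (q≢j : q ≢ j) where
  open Transposition i j

  addRoot-straight : ∀ (γ : Fin ℓ → ℤ) → γ j ≡ γ i +ℤ 1ℤ → addRoot γ (i , j) ≗ γ ∘ τ
  addRoot-straight γ γj = agree-at-pair⇒≗ i j
    (trans (addRoot-source γ i≢j) (trans (sym γj) (cong γ (sym τ-i))))
    (trans (addRoot-target γ i≢j)
      (trans (cong (_+ℤ -1ℤ) γj) (trans (i+1-1≡i (γ i)) (cong γ (sym τ-j)))))
    (λ k k≢i k≢j → trans (addRoot-other γ k≢i k≢j) (cong γ (sym (τ-other k≢i k≢j))))

  addRoot-chain : ∀ (γ : Fin ℓ → ℤ) → addRoot (addRoot γ (q , i)) (i , j) ≗ addRoot γ (q , j)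
  addRoot-chain γ = agree-at-pair⇒≗ i j
    (trans (addRoot-source (addRoot γ (q , i)) i≢j) (trans (cong (_+ℤ 1ℤ) (addRoot-target γ q≢i))
      (trans (i-1+1≡i (γ i)) (sym (addRoot-other γ (q≢i ∘ sym) i≢j)))))
    (trans (addRoot-target (addRoot γ (q , i)) i≢j)
      (trans (cong (_+ℤ -1ℤ) (addRoot-other γ (q≢j ∘ sym) (i≢j ∘ sym))) (sym (addRoot-target γ q≢j))))
    (λ k k≢i k≢j → trans (addRoot-other (addRoot γ (q , i)) k≢i k≢j)
      (trans (addRoot-off-target γ k≢i) (sym (addRoot-off-target γ k≢j))))

  addRoot-chain-straight : ∀ (γ : Fin ℓ → ℤ) → γ j ≡ γ i +ℤ 1ℤ →
    addRoot (addRoot γ (q , j)) (i , j) ≗ addRoot γ (q , i) ∘ τ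
  addRoot-chain-straight γ γj k = begin
    addRoot (addRoot γ (q , j)) (i , j) k ≡⟨ addRoot-comm γ (q , j) (i , j) k ⟩
    addRoot (addRoot γ (i , j)) (q , j) k ≡⟨ addRoot-cong (q , j) (addRoot-straight γ γj) k ⟩
    addRoot (γ ∘ τ) (q , j) k             ≡⟨ cong (λ x → addRoot (γ ∘ τ) (x , j) k) (sym (τ-other q≢i q≢j)) ⟩
    addRoot (γ ∘ τ) (τ q , j) k           ≡⟨ cong (λ x → addRoot (γ ∘ τ) (τ q , x) k) (sym τ-i) ⟩
    addRoot (γ ∘ τ) (τRoot (q , i)) k     ≡⟨ addRoot-∘τ γ (q , i) k ⟩
    addRoot γ (q , i) (τ k)               ∎
    where open ≡-Reasoning

  straight-after-lowering : ∀ (γ : Fin ℓ → ℤ) → γ j ≡ γ i +ℤ 1ℤ →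
    let w = lowerAt (addRoot γ (q , j)) i in w j ≡ w i +ℤ 1ℤ
  straight-after-lowering γ γj = begin
    shiftAt (addRoot γ (q , j)) i -1ℤ j ≡⟨ shiftAt-other (addRoot γ (q , j)) -1ℤ (i≢j ∘ sym) ⟩
    addRoot γ (q , j) j                 ≡⟨ addRoot-target γ q≢j ⟩
    γ j +ℤ -1ℤ                           ≡⟨ cong (_+ℤ -1ℤ) γj ⟩
    γ i +ℤ 1ℤ +ℤ -1ℤ                     ≡⟨ i+1-1≡i (γ i) ⟩
    γ i                                  ≡⟨ i-1+1≡i (γ i) ⟨
    γ i +ℤ -1ℤ +ℤ 1ℤ                     ≡⟨ cong (λ x → x +ℤ -1ℤ +ℤ 1ℤ) (addRoot-other γ (q≢i ∘ sym) i≢j) ⟨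
    addRoot γ (q , j) i +ℤ -1ℤ +ℤ 1ℤ     ≡⟨ cong (_+ℤ 1ℤ) (shiftAt-self (addRoot γ (q , j)) i -1ℤ) ⟨
    shiftAt (addRoot γ (q , j)) i -1ℤ i +ℤ 1ℤ ∎
    where open ≡-Reasoning

module _ {A : Set} where

  unique∧set⇒↭ : {xs ys : List A} → Unique xs → Unique ys → (∀ {z} → z ∈ xs ⇔ z ∈ ys) → xs ↭ ys
  unique∧set⇒↭ uxs uys xs≈ys = ∼bag⇒↭ (unique∧set⇒bag uxs uys xs≈ys)

  ∉∧unique⇒unique-∷ : ∀ {x} {xs : List A} → x ∉ xs → Unique xs → Unique (x ∷ xs)
  ∉∧unique⇒unique-∷ {xs = xs} x∉xs uxs = ¬Any⇒All¬ xs x∉xs ∷ uxs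

  if-[]-∈⁻ : ∀ b {x y : A} → y ∈ (if b then [ x ] else []) → y ≡ x × b ≡ true
  if-[]-∈⁻ true (here y≡x) = y≡x , refl

  if-[]-∈⁺ : ∀ {b} (x : A) → b ≡ true → x ∈ (if b then [ x ] else [])
  if-[]-∈⁺ x refl = here refl

  if-[]-unique : ∀ b (x : A) → Unique (if b then [ x ] else [])
  if-[]-unique true  x = [] ∷ []
  if-[]-unique false x = []

  count : (A → Bool) → List A → ℕ
  count f xs = length (concatMap (λ x → if f x then [ x ] else []) xs)

  count-mono : ∀ {f g : A → Bool} → (∀ x → g x ≡ true → f x ≡ true) → ∀ xs → count g xs ≤ count f xs
  count-mono         g⊆f []       = z≤n
  count-mono {f} {g} g⊆f (x ∷ xs) with f x in fx | g x in gx
  ... | true  | true  = s≤s (count-mono g⊆f xs)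
  ... | true  | false = ℕ.m≤n⇒m≤1+n (count-mono g⊆f xs)
  ... | false | false = count-mono g⊆f xs
  ... | false | true  = ⊥-elim (not-¬ (g⊆f x gx) fx)

  equal-count⇒equal-on : ∀ {f g : A → Bool} → (∀ x → g x ≡ true → f x ≡ true) →
    ∀ {xs} → count g xs ≡ count f xs → ∀ {x} → x ∈ xs → f x ≡ true → g x ≡ true
  equal-count⇒equal-on {f} {g} g⊆f {y ∷ xs} eq x∈ fx with f y in fy | g y in gy | x∈
  ... | true  | true  | here refl = gy
  ... | true  | true  | there x∈′ = equal-count⇒equal-on g⊆f (ℕ.suc-injective eq) x∈′ fx
  ... | true  | false | _ = ⊥-elim (ℕ.<-irrefl eq (s≤s (count-mono g⊆f xs)))
  ... | false | false | here refl = ⊥-elim (not-¬ fx fy)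
  ... | false | false | there x∈′ = equal-count⇒equal-on g⊆f eq x∈′ fx
  ... | false | true  | _ = ⊥-elim (not-¬ (g⊆f y gy) fy)

module _ {A B : Set} where

  concatMap-unique : ∀ (key : B → A) (f : A → List B) {xs} → Unique xs → (∀ x → Unique (f x)) →
    (∀ x {y} → y ∈ f x → key y ≡ x) → Unique (concatMap f xs)
  concatMap-unique key f {[]}     _          _  _   = []
  concatMap-unique key f {x ∷ xs} (x∉ ∷ uxs) uf key≡ =
    Unique.++⁺ (uf x) (concatMap-unique key f uxs uf key≡) disjoint
    where
    disjoint : ∀ {y} → ¬ (y ∈ f x × y ∈ concatMap f xs)
    disjoint (y∈fx , y∈rest) with find (∈-concatMap⁻ f y∈rest)
    ... | x′ , x′∈xs , y∈fx′ =
      Unique.Unique[x∷xs]⇒x∉xs (x∉ ∷ uxs) (subst (_∈ xs) (trans (sym (key≡ x′ y∈fx′)) (key≡ x y∈fx)) x′∈xs)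

module _ {ℓ} (b : Fin ℓ → Fin ℓ → Bool) where

  supportRow : Fin ℓ → List (Root ℓ)
  supportRow i = concatMap (λ j → if b i j then [ (i , j) ] else []) (allFin ℓ)

  support : List (Root ℓ)
  support = concatMap supportRow (allFin ℓ)

  ∈-supportRow⁻ : ∀ {i α} → α ∈ supportRow i → proj₁ α ≡ i × b (proj₁ α) (proj₂ α) ≡ true
  ∈-supportRow⁻ {i} α∈
    with find (∈-concatMap⁻ (λ j → if b i j then [ (i , j) ] else []) {xs = allFin ℓ} α∈)
  ... | j , _ , α∈′ with if-[]-∈⁻ (b i j) α∈′
  ...   | refl , bij = refl , bij

  ∈-support⁻ : ∀ {i j} → (i , j) ∈ support → b i j ≡ true
  ∈-support⁻ α∈ with find (∈-concatMap⁻ supportRow {xs = allFin ℓ} α∈)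
  ... | _ , _ , α∈row = proj₂ (∈-supportRow⁻ α∈row)

  ∈-support⁺ : ∀ {i j} → b i j ≡ true → (i , j) ∈ support
  ∈-support⁺ {i} {j} bij = ∈-concatMap⁺ supportRow (lose (∈-allFin i)
    (∈-concatMap⁺ (λ j → if b i j then [ (i , j) ] else []) (lose (∈-allFin j) (if-[]-∈⁺ (i , j) bij))))

  support-unique : Unique support
  support-unique = concatMap-unique proj₁ supportRow (Unique.allFin⁺ ℓ)
    (λ i → concatMap-unique proj₂ (λ j → if b i j then [ (i , j) ] else []) (Unique.allFin⁺ ℓ)
             (λ j → if-[]-unique (b i j) (i , j)) (λ j α∈ → cong proj₂ (proj₁ (if-[]-∈⁻ (b i j) α∈))))
    (λ i α∈ → proj₁ (∈-supportRow⁻ α∈))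

module _ {ℓ} {Ψ : RootSet ℓ} where

  private
    complementTest : Fin ℓ → Fin ℓ → Bool
    complementTest i j = does (i Fin.<? j) ∧ not (Ψ i j)

    ∧-not≡true⁻ : ∀ {A : Set} (a? : Dec A) x → (does a? ∧ not x) ≡ true → A × x ≡ false
    ∧-not≡true⁻ (yes a) false _ = a , refl
    ∧-not≡true⁻ (yes a) true  ()
    ∧-not≡true⁻ (no _)  _     ()

    ∧-not≡true⁺ : ∀ {A : Set} (a? : Dec A) {x} → A → x ≡ false → (does a? ∧ not x) ≡ true
    ∧-not≡true⁺ (yes _) _ refl = refl
    ∧-not≡true⁺ (no ¬a) a _    = ⊥-elim (¬a a)

  ∈-complementRoots⁻ : ∀ {i j} → (i , j) ∈ complementRoots Ψ → i Fin.< j × Ψ i j ≡ false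
  ∈-complementRoots⁻ {i} {j} α∈ = ∧-not≡true⁻ (i Fin.<? j) (Ψ i j) (∈-support⁻ complementTest α∈)

  ∈-complementRoots⁺ : ∀ {i j} → i Fin.< j → Ψ i j ≡ false → (i , j) ∈ complementRoots Ψ
  ∈-complementRoots⁺ {i} {j} i<j Ψij = ∈-support⁺ complementTest (∧-not≡true⁺ (i Fin.<? j) i<j Ψij)

  complementRoots-unique : Unique (complementRoots Ψ)
  complementRoots-unique = support-unique complementTest

≡true⇔⇒≡ : ∀ {x y : Bool} → (x ≡ true → y ≡ true) → (y ≡ true → x ≡ true) → x ≡ y
≡true⇔⇒≡ {true}  {true}  _   _   = refl
≡true⇔⇒≡ {false} {false} _   _   = refl
≡true⇔⇒≡ {true}  {false} x⇒y _   = sym (x⇒y refl)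
≡true⇔⇒≡ {false} {true}  _   y⇒x = y⇒x refl

≢true⇒≡false : ∀ {x : Bool} → x ≢ true → x ≡ false
≢true⇒≡false {true}  x≢true = ⊥-elim (x≢true refl)
≢true⇒≡false {false} _      = refl

_≟Root_ : ∀ {ℓ} → (α β : Root ℓ) → Dec (α ≡ β)
_≟Root_ = ≡-dec _≟_ _≟_

module BounceConfiguration {ℓ} (Ψ : RootSet ℓ) (Ψ-ideal : IsRootIdeal Ψ) {p p₁ q : Fin ℓ}
  (p≡p₁+1 : toℕ p ≡ suc (toℕ p₁)) (edge : BounceEdge Ψ p q) (β-addable : Addable Ψ (q , p₁))
  (wall : Wall Ψ p₁ p) where

  Ψ′ : RootSet ℓ
  Ψ′ = insertR Ψ (q , p₁)

  q<p₁ : q Fin.< p₁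
  q<p₁ = proj₁ β-addable

  p₁<p : p₁ Fin.< p
  p₁<p = subst (toℕ p₁ ℕ.<_) (sym p≡p₁+1) (ℕ.n<1+n (toℕ p₁))

  q<p : q Fin.< p
  q<p = Fin.<-trans q<p₁ p₁<p

  p₁≢p : p₁ ≢ p
  p₁≢p = Fin.<⇒≢ p₁<p

  q≢p₁ : q ≢ p₁
  q≢p₁ = Fin.<⇒≢ q<p₁

  q≢p : q ≢ p
  q≢p = Fin.<⇒≢ q<p

  Ψ-upper : ∀ {i j i′ j′} → Ψ i j ≡ true → i′ Fin.≤ i → j Fin.≤ j′ → Ψ i′ j′ ≡ true
  Ψ-upper = IsRootIdeal.upper Ψ-ideal _ _ _ _

  Ψ′-upper : ∀ {i j i′ j′} → Ψ′ i j ≡ true → i′ Fin.≤ i → j Fin.≤ j′ → Ψ′ i′ j′ ≡ true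
  Ψ′-upper = IsRootIdeal.upper (proj₂ (proj₂ β-addable)) _ _ _ _

  Ψ-irreflexive : ∀ i → Ψ i i ≡ false
  Ψ-irreflexive i = ≢true⇒≡false (λ Ψii → Fin.<-irrefl refl (IsRootIdeal.⊆Δ⁺ Ψ-ideal i i Ψii))

  Ψ′-β : Ψ′ q p₁ ≡ true
  Ψ′-β rewrite dec-true (q ≟ q) refl | dec-true (p₁ ≟ p₁) refl = refl

  Ψ′-other : ∀ {a b} → (a , b) ≢ (q , p₁) → Ψ′ a b ≡ Ψ a b
  Ψ′-other {a} {b} ab≢β with a ≟ q | b ≟ p₁
  ... | yes refl | yes refl = ⊥-elim (ab≢β refl)
  ... | yes _    | no _     = refl
  ... | no _     | _        = refl

  Ψ′-row : ∀ {a} b → a ≢ q → Ψ′ a b ≡ Ψ a b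
  Ψ′-row b a≢q = Ψ′-other (a≢q ∘ cong proj₁)

  Ψ′-column : ∀ a {b} → b ≢ p₁ → Ψ′ a b ≡ Ψ a b
  Ψ′-column a b≢p₁ = Ψ′-other (b≢p₁ ∘ cong proj₂)

  Ψ⊆Ψ′ : ∀ {a b} → Ψ a b ≡ true → Ψ′ a b ≡ true
  Ψ⊆Ψ′ {a} {b} Ψab with (a , b) ≟Root (q , p₁)
  ... | yes refl = Ψ′-β
  ... | no ab≢β  = trans (Ψ′-other ab≢β) Ψab

  Ψ′⊆Ψ∪β : ∀ {a b} → Ψ′ a b ≡ true → (a , b) ≡ (q , p₁) ⊎ Ψ a b ≡ true
  Ψ′⊆Ψ∪β {a} {b} Ψ′ab with (a , b) ≟Root (q , p₁)
  ... | yes ab≡β = inj₁ ab≡β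
  ... | no ab≢β  = inj₂ (trans (sym (Ψ′-other ab≢β)) Ψ′ab)

  rows-equal : ∀ b → Ψ p₁ b ≡ Ψ p b
  rows-equal b = ≡true⇔⇒≡
    (equal-count⇒equal-on p-row⊆p₁-row (sym wall) (∈-allFin b))
    (p-row⊆p₁-row b)
    where
    p-row⊆p₁-row : ∀ b → Ψ p b ≡ true → Ψ p₁ b ≡ true
    p-row⊆p₁-row b Ψpb = Ψ-upper Ψpb (ℕ.<⇒≤ p₁<p) Fin.≤-refl

  rows-equal′ : ∀ b → Ψ′ p₁ b ≡ Ψ′ p b
  rows-equal′ b = trans (Ψ′-row b (q≢p₁ ∘ sym)) (trans (rows-equal b) (sym (Ψ′-row b (q≢p ∘ sym))))

  Ψ-bounce : ∀ {a} → q Fin.< a → Ψ a p ≡ false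
  Ψ-bounce {a} q<a = ≢true⇒≡false λ Ψap →
    not-¬ (IsRootIdeal.upper (proj₂ edge) a p q p (removeR-other Ψap) (ℕ.<⇒≤ q<a) Fin.≤-refl) removeR-β
    where
    removeR-β : removeR Ψ (q , p) q p ≡ false
    removeR-β rewrite dec-true (q ≟ q) refl | dec-true (p ≟ p) refl = ∧-zeroʳ (Ψ q p)
    removeR-other : Ψ a p ≡ true → removeR Ψ (q , p) a p ≡ true
    removeR-other Ψap with a ≟ q
    ... | yes a≡q = ⊥-elim (Fin.<⇒≢ q<a (sym a≡q))
    ... | no _    = trans (∧-identityʳ (Ψ a p)) Ψap

  columns-equal′ : ∀ a → Ψ′ a p₁ ≡ Ψ′ a p
  columns-equal′ a = trans (≡true⇔⇒≡ ⇒Ψap Ψap⇒) (sym (Ψ′-column a (p₁≢p ∘ sym)))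
    where
    ⇒Ψap : Ψ′ a p₁ ≡ true → Ψ a p ≡ true
    ⇒Ψap Ψ′ap₁ with Ψ′⊆Ψ∪β Ψ′ap₁
    ... | inj₁ refl = proj₁ edge
    ... | inj₂ Ψap₁ = Ψ-upper Ψap₁ Fin.≤-refl (ℕ.<⇒≤ p₁<p)
    Ψap⇒ : Ψ a p ≡ true → Ψ′ a p₁ ≡ true
    Ψap⇒ Ψap with ℕ.≤-<-connex (toℕ a) (toℕ q)
    ... | inj₁ a≤q = Ψ′-upper Ψ′-β a≤q Fin.≤-refl
    ... | inj₂ q<a = ⊥-elim (not-¬ Ψap (Ψ-bounce q<a))

  open Transposition p₁ p

  Ψ′-swap-invariant : ∀ a b → Ψ′ (τ a) (τ b) ≡ Ψ′ a b
  Ψ′-swap-invariant a b =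
    trans (∘τ≗ (λ x → Ψ′ x (τ b)) (rows-equal′ (τ b)) a) (∘τ≗ (Ψ′ a) (columns-equal′ a) b)

  swap-preserves-< : ∀ {a b} → a Fin.< b → (a , b) ≢ (p₁ , p) → τ a Fin.< τ b
  swap-preserves-< {a} {b} a<b ab≢ = by-cases (a ≟ p₁) (a ≟ p) (b ≟ p₁) (b ≟ p)
    where
    above-p : ∀ {k} → p₁ Fin.< k → k ≢ p → p Fin.< k
    above-p p₁<k k≢p = Fin.≤∧≢⇒< (subst (ℕ._≤ _) (sym p≡p₁+1) p₁<k) (k≢p ∘ sym)
    below-p₁ : ∀ {k} → k Fin.< p → k ≢ p₁ → k Fin.< p₁
    below-p₁ k<p k≢p₁ = Fin.≤∧≢⇒< (ℕ.m<1+n⇒m≤n (subst (_ ℕ.<_) p≡p₁+1 k<p)) k≢p₁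
    by-cases : Dec (a ≡ p₁) → Dec (a ≡ p) → Dec (b ≡ p₁) → Dec (b ≡ p) → τ a Fin.< τ b
    by-cases (yes refl) _ _ (yes refl) = ⊥-elim (ab≢ refl)
    by-cases (yes refl) _ (yes refl) _ = ⊥-elim (Fin.<-irrefl refl a<b)
    by-cases (yes refl) _ (no b≢p₁) (no b≢p) =
      subst₂ Fin._<_ (sym τ-i) (sym (τ-other b≢p₁ b≢p)) (above-p a<b b≢p)
    by-cases (no _) (yes refl) (yes refl) _ = ⊥-elim (Fin.<-asym a<b p₁<p)
    by-cases (no _) (yes refl) _ (yes refl) = ⊥-elim (Fin.<-irrefl refl a<b)
    by-cases (no _) (yes refl) (no b≢p₁) (no b≢p) =
      subst₂ Fin._<_ (sym τ-j) (sym (τ-other b≢p₁ b≢p)) (Fin.<-trans p₁<p a<b)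
    by-cases (no a≢p₁) (no a≢p) (yes refl) _ =
      subst₂ Fin._<_ (sym (τ-other a≢p₁ a≢p)) (sym τ-i) (Fin.<-trans a<b p₁<p)
    by-cases (no a≢p₁) (no a≢p) (no _) (yes refl) =
      subst₂ Fin._<_ (sym (τ-other a≢p₁ a≢p)) (sym τ-j) (below-p₁ a<b a≢p₁)
    by-cases (no a≢p₁) (no a≢p) (no b≢p₁) (no b≢p) =
      subst₂ Fin._<_ (sym (τ-other a≢p₁ a≢p)) (sym (τ-other b≢p₁ b≢p)) a<b

  Ψ′-p₁p : Ψ′ p₁ p ≡ false
  Ψ′-p₁p = trans (rows-equal′ p) (trans (Ψ′-row p (q≢p ∘ sym)) (Ψ-irreflexive p))

  Rest : List (Root ℓ)
  Rest = filter (λ α → ¬? (α ≟Root (p₁ , p))) (complementRoots Ψ′)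

  Rest-unique : Unique Rest
  Rest-unique = Unique.filter⁺ _ complementRoots-unique

  ∈-Rest⁻ : ∀ {a b} → (a , b) ∈ Rest → a Fin.< b × Ψ′ a b ≡ false × (a , b) ≢ (p₁ , p)
  ∈-Rest⁻ ab∈ with ∈-filter⁻ (λ α → ¬? (α ≟Root (p₁ , p))) {xs = complementRoots Ψ′} ab∈
  ... | ab∈′ , ab≢ = proj₁ (∈-complementRoots⁻ ab∈′) , proj₂ (∈-complementRoots⁻ ab∈′) , ab≢

  ∈-Rest⁺ : ∀ {a b} → a Fin.< b → Ψ′ a b ≡ false → (a , b) ≢ (p₁ , p) → (a , b) ∈ Rest
  ∈-Rest⁺ a<b Ψ′ab ab≢ = ∈-filter⁺ (λ α → ¬? (α ≟Root (p₁ , p))) (∈-complementRoots⁺ a<b Ψ′ab) ab≢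

  Rest-closed-under-swap : ∀ {α} → α ∈ Rest → τRoot α ∈ Rest
  Rest-closed-under-swap {a , b} ab∈ with ∈-Rest⁻ ab∈
  ... | a<b , Ψ′ab , ab≢ =
    ∈-Rest⁺ (swap-preserves-< a<b ab≢) (trans (Ψ′-swap-invariant a b) Ψ′ab) τab≢
    where
    τab≢ : τRoot (a , b) ≢ (p₁ , p)
    τab≢ e = Fin.<-asym a<b (subst₂ Fin._<_
      (trans (sym τ-j) (trans (cong (τ ∘ proj₂) (sym e)) (τ-involutive b)))
      (trans (sym τ-i) (trans (cong (τ ∘ proj₁) (sym e)) (τ-involutive a))) p₁<p)

  complementRoots-split-β : complementRoots Ψ ↭ (q , p₁) ∷ complementRoots Ψ′
  complementRoots-split-β = unique∧set⇒↭ complementRoots-unique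
    (∉∧unique⇒unique-∷ β∉ complementRoots-unique) (mk⇔ to from)
    where
    β∉ : (q , p₁) ∉ complementRoots Ψ′
    β∉ β∈ = not-¬ Ψ′-β (proj₂ (∈-complementRoots⁻ β∈))
    to : ∀ {α} → α ∈ complementRoots Ψ → α ∈ (q , p₁) ∷ complementRoots Ψ′
    to {a , b} ab∈ with (a , b) ≟Root (q , p₁) | ∈-complementRoots⁻ ab∈
    ... | yes ab≡β | _           = here ab≡β
    ... | no ab≢β  | a<b , Ψab   = there (∈-complementRoots⁺ a<b (trans (Ψ′-other ab≢β) Ψab))
    from : ∀ {α} → α ∈ (q , p₁) ∷ complementRoots Ψ′ → α ∈ complementRoots Ψ
    from (here refl) = ∈-complementRoots⁺ q<p₁ (proj₁ (proj₂ β-addable))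
    from (there ab∈) with ∈-complementRoots⁻ ab∈
    ... | a<b , Ψ′ab = ∈-complementRoots⁺ a<b (≢true⇒≡false (λ Ψab → not-¬ (Ψ⊆Ψ′ Ψab) Ψ′ab))

  complementRoots′-split : complementRoots Ψ′ ↭ (p₁ , p) ∷ Rest
  complementRoots′-split = unique∧set⇒↭ complementRoots-unique
    (∉∧unique⇒unique-∷ (λ p₁p∈ → proj₂ (proj₂ (∈-Rest⁻ p₁p∈)) refl) Rest-unique) (mk⇔ to from)
    where
    to : ∀ {α} → α ∈ complementRoots Ψ′ → α ∈ (p₁ , p) ∷ Rest
    to {a , b} ab∈ with (a , b) ≟Root (p₁ , p) | ∈-complementRoots⁻ ab∈
    ... | yes ab≡ | _          = here ab≡
    ... | no ab≢  | a<b , Ψ′ab = there (∈-Rest⁺ a<b Ψ′ab ab≢)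
    from : ∀ {α} → α ∈ (p₁ , p) ∷ Rest → α ∈ complementRoots Ψ′
    from (here refl) = ∈-complementRoots⁺ p₁<p Ψ′-p₁p
    from {a , b} (there ab∈) = ∈-complementRoots⁺ (proj₁ (∈-Rest⁻ ab∈)) (proj₁ (proj₂ (∈-Rest⁻ ab∈)))

  Rest-swap-invariant : map τRoot Rest ↭ Rest
  Rest-swap-invariant = unique∧set⇒↭ (Unique.map⁺ τRoot-injective Rest-unique) Rest-unique (mk⇔ to from)
    where
    τRoot-injective : ∀ {α β} → τRoot α ≡ τRoot β → α ≡ β
    τRoot-injective {α} {β} e = trans (sym (τRoot-involutive α)) (trans (cong τRoot e) (τRoot-involutive β))
    to : ∀ {α} → α ∈ map τRoot Rest → α ∈ Rest
    to α∈ with ∈-map⁻ τRoot α∈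
    ... | β , β∈ , refl = Rest-closed-under-swap β∈
    from : ∀ {α} → α ∈ Rest → α ∈ map τRoot Rest
    from {α} α∈ = subst (_∈ map τRoot Rest) (τRoot-involutive α) (∈-map⁺ τRoot (Rest-closed-under-swap α∈))

module KatalanExpansion {c ℓr : Level} (R : CommutativeRing c ℓr)
                        (h : ℕ → CommutativeRing.Carrier R) where

  open CommutativeRing R hiding (refl; sym; trans)
  open CommutativeRing R using () renaming (refl to ≈-refl; sym to ≈-sym; trans to ≈-trans)
  open Katalan R h
  open import Algebra.Properties.Ring ring using (-0#≈0#; -‿+-comm; -‿distribˡ-*; x[y-z]≈xy-xz; [y-z]x≈yx-zx)
  open import Algebra.Properties.AbelianGroup +-abelianGroup using (⁻¹-anti-homo‿-)
  import Algebra.Solver.CommutativeMonoid as CMSolver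
  module +-Solver = CMSolver +-commutativeMonoid
  module *-Solver = CMSolver *-commutativeMonoid
  open import Relation.Binary.Reasoning.Setoid setoid
  module ∏ = Algebra.Properties.CommutativeMonoid.Sum *-commutativeMonoid

  x-0#≈x : ∀ x → x - 0# ≈ x
  x-0#≈x x = ≈-trans (+-congˡ -0#≈0#) (+-identityʳ x)

  [a+b]+[c+d]≈[a+c]+[b+d] : ∀ a b c d → (a + b) + (c + d) ≈ (a + c) + (b + d)
  [a+b]+[c+d]≈[a+c]+[b+d] = +-Solver.solve 4 (λ a b c d → (a ⊕ b) ⊕ (c ⊕ d) ⊜ (a ⊕ c) ⊕ (b ⊕ d)) ≈-refl
    where open +-Solver

  [a-b]-[c-d]≈[a-c]-[b-d] : ∀ a b c d → (a - b) - (c - d) ≈ (a - c) - (b - d)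
  [a-b]-[c-d]≈[a-c]-[b-d] a b c d = begin
    (a - b) + - (c - d)    ≈⟨ +-congˡ (-‿+-comm c (- d)) ⟨
    (a - b) + (- c + - - d) ≈⟨ [a+b]+[c+d]≈[a+c]+[b+d] a (- b) (- c) (- - d) ⟩
    (a - c) + (- b + - - d) ≈⟨ +-congˡ (-‿+-comm b (- d)) ⟩
    (a - c) + - (b - d)    ∎

  sign-+ : ∀ m n → sign (m ℕ.+ n) ≈ sign m * sign n
  sign-+ zero    n = ≈-sym (*-identityˡ _)
  sign-+ (suc m) n = ≈-trans (-‿cong (sign-+ m n)) (-‿distribˡ-* _ _)

  natR-+ : ∀ m n → natR (m ℕ.+ n) ≈ natR m + natR n
  natR-+ zero    n = ≈-sym (+-identityˡ _)
  natR-+ (suc m) n = ≈-trans (+-congˡ (natR-+ m n)) (≈-sym (+-assoc _ _ _))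

  natR-* : ∀ m n → natR (m ℕ.* n) ≈ natR m * natR n
  natR-* zero    n = ≈-sym (zeroˡ _)
  natR-* (suc m) n = begin
    natR (n ℕ.+ m ℕ.* n)             ≈⟨ natR-+ n (m ℕ.* n) ⟩
    natR n + natR (m ℕ.* n)          ≈⟨ +-cong (≈-sym (*-identityˡ _)) (natR-* m n) ⟩
    1# * natR n + natR m * natR n    ≈⟨ distribʳ _ _ _ ⟨
    (1# + natR m) * natR n           ∎

  sumR-++ : ∀ xs ys → sumR (xs ++ ys) ≈ sumR xs + sumR ys
  sumR-++ []       ys = ≈-sym (+-identityˡ _)
  sumR-++ (x ∷ xs) ys = ≈-trans (+-congˡ (sumR-++ xs ys)) (≈-sym (+-assoc _ _ _))

  module _ {A : Set} where

    sumR-cong : ∀ {f g : A → Carrier} xs → (∀ x → f x ≈ g x) → sumR (map f xs) ≈ sumR (map g xs)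
    sumR-cong []       f≈g = ≈-refl
    sumR-cong (x ∷ xs) f≈g = +-cong (f≈g x) (sumR-cong xs f≈g)

    sumR-map-++ : ∀ (f : A → Carrier) xs ys → sumR (map f (xs ++ ys)) ≈ sumR (map f xs) + sumR (map f ys)
    sumR-map-++ f xs ys = ≈-trans (reflexive (cong sumR (map-++ f xs ys))) (sumR-++ (map f xs) (map f ys))

    sumR-map-neg : ∀ (f : A → Carrier) xs → sumR (map (λ x → - f x) xs) ≈ - sumR (map f xs)
    sumR-map-neg f []       = ≈-sym -0#≈0#
    sumR-map-neg f (x ∷ xs) = ≈-trans (+-congˡ (sumR-map-neg f xs)) (-‿+-comm _ _)

    sumR-map-minus : ∀ (f g : A → Carrier) xs →
      sumR (map (λ x → f x - g x) xs) ≈ sumR (map f xs) - sumR (map g xs)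
    sumR-map-minus f g []       = ≈-sym (x-0#≈x 0#)
    sumR-map-minus f g (x ∷ xs) = ≈-trans (+-congˡ (sumR-map-minus f g xs))
      (≈-trans ([a+b]+[c+d]≈[a+c]+[b+d] _ _ _ _) (+-congˡ (-‿+-comm _ _)))

    sumR-map-*ˡ : ∀ a (f : A → Carrier) xs → sumR (map (λ x → a * f x) xs) ≈ a * sumR (map f xs)
    sumR-map-*ˡ a f []       = ≈-sym (zeroʳ a)
    sumR-map-*ˡ a f (x ∷ xs) = ≈-trans (+-congˡ (sumR-map-*ˡ a f xs)) (≈-sym (distribˡ a _ _))

    sumR-map-*ʳ : ∀ a (f : A → Carrier) xs → sumR (map (λ x → f x * a) xs) ≈ sumR (map f xs) * a
    sumR-map-*ʳ a f []       = ≈-sym (zeroˡ a)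
    sumR-map-*ʳ a f (x ∷ xs) = ≈-trans (+-congˡ (sumR-map-*ʳ a f xs)) (≈-sym (distribʳ a _ _))

  module _ {A B : Set} where

    sumR-map-map : ∀ (f : B → Carrier) (g : A → B) xs → sumR (map f (map g xs)) ≡ sumR (map (f ∘ g) xs)
    sumR-map-map f g xs = cong sumR (sym (map-∘ xs))

    sumR-map-concatMap : ∀ (f : B → Carrier) (g : A → List B) xs →
      sumR (map f (concatMap g xs)) ≈ sumR (map (λ x → sumR (map f (g x))) xs)
    sumR-map-concatMap f g []       = ≈-refl
    sumR-map-concatMap f g (x ∷ xs) =
      ≈-trans (sumR-map-++ f (g x) (concatMap g xs)) (+-congˡ (sumR-map-concatMap f g xs))

  module _ {ℓ : ℕ} where

    Respects≗ : ((Fin ℓ → ℤ) → Carrier) → Set _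
    Respects≗ F = ∀ {u v} → u ≗ v → F u ≈ F v

    Φ : List (Root ℓ) → ((Fin ℓ → ℤ) → Carrier) → (Fin ℓ → ℤ) → Carrier
    Φ L F γ = sumR (map (λ S → sign (length S) * F (addRoots γ S)) (subsets L))

    Φ-[] : ∀ F γ → Φ [] F γ ≈ F γ
    Φ-[] F γ = ≈-trans (+-identityʳ _) (*-identityˡ _)

    Φ-resp : ∀ L {F} → Respects≗ F → Respects≗ (Φ L F)
    Φ-resp L F-resp u≗v = sumR-cong (subsets L) (λ S → *-congˡ (F-resp (addRoots-cong S u≗v)))

    Φ-∷ : ∀ α L {F} → Respects≗ F → ∀ γ → Φ (α ∷ L) F γ ≈ Φ L F γ - Φ L F (addRoot γ α)
    Φ-∷ α L {F} F-resp γ = begin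
      Φ (α ∷ L) F γ
        ≈⟨ sumR-map-++ term (subsets L) (map (α ∷_) (subsets L)) ⟩
      Φ L F γ + sumR (map term (map (α ∷_) (subsets L)))
        ≡⟨ cong (λ z → Φ L F γ + z) (sumR-map-map term (α ∷_) (subsets L)) ⟩
      Φ L F γ + sumR (map (term ∘ (α ∷_)) (subsets L))
        ≈⟨ +-congˡ (sumR-cong (subsets L) (λ S → ≈-trans (≈-sym (-‿distribˡ-* _ _))
             (-‿cong (*-congˡ (F-resp (addRoot-addRoots γ α S)))))) ⟩
      Φ L F γ + sumR (map (λ S → - (sign (length S) * F (addRoots (addRoot γ α) S))) (subsets L))
        ≈⟨ +-congˡ (sumR-map-neg _ (subsets L)) ⟩
      Φ L F γ - Φ L F (addRoot γ α) ∎
      where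
      term : List (Root ℓ) → Carrier
      term S = sign (length S) * F (addRoots γ S)

    Φ-↭ : ∀ {L L′ F} → Respects≗ F → L ↭ L′ → ∀ γ → Φ L F γ ≈ Φ L′ F γ
    Φ-↭ F-resp _↭_.refl γ = ≈-refl
    Φ-↭ {F = F} F-resp (_↭_.prep {xs} {ys} α xs↭ys) γ = begin
      Φ (α ∷ xs) F γ                   ≈⟨ Φ-∷ α xs F-resp γ ⟩
      Φ xs F γ - Φ xs F (addRoot γ α)  ≈⟨ +-cong (Φ-↭ F-resp xs↭ys γ) (-‿cong (Φ-↭ F-resp xs↭ys _)) ⟩
      Φ ys F γ - Φ ys F (addRoot γ α)  ≈⟨ Φ-∷ α ys F-resp γ ⟨
      Φ (α ∷ ys) F γ                   ∎
    Φ-↭ {F = F} F-resp (_↭_.swap {xs} {ys} α β xs↭ys) γ = begin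
      Φ (α ∷ β ∷ xs) F γ
        ≈⟨ ≈-trans (Φ-∷ α (β ∷ xs) F-resp γ) (+-cong (Φ-∷ β xs F-resp γ) (-‿cong (Φ-∷ β xs F-resp _))) ⟩
      (Φ xs F γ - Φ xs F (γ ⊕ β)) - (Φ xs F (γ ⊕ α) - Φ xs F ((γ ⊕ α) ⊕ β))
        ≈⟨ [a-b]-[c-d]≈[a-c]-[b-d] _ _ _ _ ⟩
      (Φ xs F γ - Φ xs F (γ ⊕ α)) - (Φ xs F (γ ⊕ β) - Φ xs F ((γ ⊕ α) ⊕ β))
        ≈⟨ +-cong (+-cong (Φ-↭ F-resp xs↭ys γ) (-‿cong (Φ-↭ F-resp xs↭ys _)))
                  (-‿cong (+-cong (Φ-↭ F-resp xs↭ys _)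
                    (-‿cong (≈-trans (Φ-↭ F-resp xs↭ys _) (Φ-resp ys F-resp (addRoot-comm γ α β)))))) ⟩
      (Φ ys F γ - Φ ys F (γ ⊕ α)) - (Φ ys F (γ ⊕ β) - Φ ys F ((γ ⊕ β) ⊕ α))
        ≈⟨ ≈-trans (Φ-∷ β (α ∷ ys) F-resp γ) (+-cong (Φ-∷ α ys F-resp γ) (-‿cong (Φ-∷ α ys F-resp _))) ⟨
      Φ (β ∷ α ∷ ys) F γ ∎
      where
      _⊕_ : (Fin ℓ → ℤ) → Root ℓ → (Fin ℓ → ℤ)
      _⊕_ = addRoot
    Φ-↭ F-resp (_↭_.trans L↭L′ L′↭L″) γ = ≈-trans (Φ-↭ F-resp L↭L′ γ) (Φ-↭ F-resp L′↭L″ γ)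

    Φ-lowering : ∀ L {F F′} r → Respects≗ F → (∀ v → F′ v ≈ F v - F (lowerAt v r)) →
      ∀ γ → Φ L F′ γ ≈ Φ L F γ - Φ L F (lowerAt γ r)
    Φ-lowering L {F} {F′} r F-resp F′≈ γ = begin
      Φ L F′ γ
        ≈⟨ sumR-cong (subsets L) (λ S → ≈-trans (*-congˡ (F′≈ (addRoots γ S))) (x[y-z]≈xy-xz _ _ _)) ⟩
      sumR (map (λ S → sign (length S) * F (addRoots γ S)
                       - sign (length S) * F (lowerAt (addRoots γ S) r)) (subsets L))
        ≈⟨ sumR-map-minus _ _ (subsets L) ⟩
      Φ L F γ - sumR (map (λ S → sign (length S) * F (lowerAt (addRoots γ S) r)) (subsets L))
        ≈⟨ +-congˡ (-‿cong (sumR-cong (subsets L) (λ S → *-congˡ (F-resp (addRoots-shiftAt γ r -1ℤ S))))) ⟩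
      Φ L F γ - Φ L F (lowerAt γ r) ∎

    module _ (i j : Fin ℓ) where
      open Transposition i j

      Φ-swap : ∀ L {F} → Respects≗ F → (∀ v → F (v ∘ τ) ≈ F v) →
        ∀ v → Φ (map τRoot L) F (v ∘ τ) ≈ Φ L F v
      Φ-swap []      {F} F-resp Fτ v = ≈-trans (Φ-[] F _) (≈-trans (Fτ v) (≈-sym (Φ-[] F v)))
      Φ-swap (α ∷ L) {F} F-resp Fτ v = begin
        Φ (τRoot α ∷ map τRoot L) F (v ∘ τ)
          ≈⟨ Φ-∷ (τRoot α) (map τRoot L) F-resp _ ⟩
        Φ (map τRoot L) F (v ∘ τ) - Φ (map τRoot L) F (addRoot (v ∘ τ) (τRoot α))
          ≈⟨ +-congˡ (-‿cong (Φ-resp (map τRoot L) F-resp (addRoot-∘τ v α))) ⟩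
        Φ (map τRoot L) F (v ∘ τ) - Φ (map τRoot L) F (addRoot v α ∘ τ)
          ≈⟨ +-cong (Φ-swap L F-resp Fτ v) (-‿cong (Φ-swap L F-resp Fτ (addRoot v α))) ⟩
        Φ L F v - Φ L F (addRoot v α)
          ≈⟨ Φ-∷ α L F-resp v ⟨
        Φ (α ∷ L) F v ∎

  sumTo : ℕ → (ℕ → Carrier) → Carrier
  sumTo zero    f = 0#
  sumTo (suc n) f = f 0 + sumTo n (f ∘ suc)

  sumR-map-applyUpTo : ∀ n (f : ℕ → Carrier) g → sumR (map f (applyUpTo g n)) ≡ sumTo n (f ∘ g)
  sumR-map-applyUpTo zero    f g = refl
  sumR-map-applyUpTo (suc n) f g = cong (λ z → f (g 0) + z) (sumR-map-applyUpTo n f (g ∘ suc))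

  sumTo-cong : ∀ n {f g} → (∀ a → f a ≈ g a) → sumTo n f ≈ sumTo n g
  sumTo-cong zero    f≈g = ≈-refl
  sumTo-cong (suc n) f≈g = +-cong (f≈g 0) (sumTo-cong n (f≈g ∘ suc))

  sumTo-+ : ∀ n f g → sumTo n (λ a → f a + g a) ≈ sumTo n f + sumTo n g
  sumTo-+ zero    f g = ≈-sym (+-identityʳ _)
  sumTo-+ (suc n) f g =
    ≈-trans (+-congˡ (sumTo-+ n (f ∘ suc) (g ∘ suc))) ([a+b]+[c+d]≈[a+c]+[b+d] _ _ _ _)

  sumTo-neg : ∀ n f → sumTo n (λ a → - f a) ≈ - sumTo n f
  sumTo-neg zero    f = ≈-sym -0#≈0#
  sumTo-neg (suc n) f = ≈-trans (+-congˡ (sumTo-neg n (f ∘ suc))) (-‿+-comm _ _)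

  sumTo-suc : ∀ n f → sumTo (suc n) f ≈ sumTo n f + f n
  sumTo-suc zero    f = ≈-trans (+-identityʳ _) (≈-sym (+-identityˡ _))
  sumTo-suc (suc n) f = ≈-trans (+-congˡ (sumTo-suc n (f ∘ suc))) (≈-sym (+-assoc _ _ _))

  natR-pascal : ∀ m a → natR (suc m C suc a) ≈ natR (m C a) + natR (m C suc a)
  natR-pascal m a =
    ≈-trans (reflexive (cong natR (sym (nCk+nC[k+1]≡[n+1]C[k+1] m a)))) (natR-+ (m C a) (m C suc a))

  diff : (ℤ → Carrier) → ℤ → Carrier
  diff f n = f n - f (n ℤ.- 1ℤ)

  diffPow : ℕ → (ℤ → Carrier) → ℤ → Carrier
  diffPow m f n = sumR (map (λ a → sign a * natR (m C a) * f (n ℤ.- + a)) (upTo (suc m)))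

  diffPow-cong : ∀ m {f g} → (∀ n → f n ≈ g n) → ∀ n → diffPow m f n ≈ diffPow m g n
  diffPow-cong m f≈g n = sumR-cong (upTo (suc m)) (λ a → *-congˡ (f≈g _))

  diffPow-sumTo : ∀ m f n → diffPow m f n ≡ sumTo (suc m) (λ a → sign a * natR (m C a) * f (n ℤ.- + a))
  diffPow-sumTo m f n = sumR-map-applyUpTo (suc m) _ (λ a → a)

  n-a-1≡n-1-a : ∀ n a → n ℤ.- + a ℤ.- 1ℤ ≡ n ℤ.- 1ℤ ℤ.- + a
  n-a-1≡n-1-a n a = trans (ℤ.+-assoc n (ℤ.- + a) -1ℤ)
    (trans (cong (n +ℤ_) (ℤ.+-comm (ℤ.- + a) -1ℤ)) (sym (ℤ.+-assoc n -1ℤ (ℤ.- + a))))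

  n-[1+a]≡n-1-a : ∀ n a → n ℤ.- + suc a ≡ n ℤ.- 1ℤ ℤ.- + a
  n-[1+a]≡n-1-a n a = trans (cong (n +ℤ_) (ℤ.neg-distrib-+ 1ℤ (+ a))) (sym (ℤ.+-assoc n -1ℤ (ℤ.- + a)))

  diffPow-diff : ∀ m f n → diffPow m (diff f) n ≈ diff (diffPow m f) n
  diffPow-diff m f n = ≈-trans
    (sumR-cong (upTo (suc m)) (λ a → ≈-trans (x[y-z]≈xy-xz _ _ _)
      (+-congˡ (-‿cong (*-congˡ (reflexive (cong f (n-a-1≡n-1-a n a))))))))
    (sumR-map-minus _ _ (upTo (suc m)))

  diffPow-suc : ∀ m f n → diffPow (suc m) f n ≈ diff (diffPow m f) n
  diffPow-suc m f n = begin
    diffPow (suc m) f n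
      ≡⟨ diffPow-sumTo (suc m) f n ⟩
    t m 0 + sumTo (suc m) (λ a → t (suc m) (suc a))
      ≈⟨ +-congˡ (≈-trans (sumTo-cong (suc m) pascal-step) (sumTo-+ (suc m) (λ a → - u a) (λ a → t m (suc a)))) ⟩
    t m 0 + (sumTo (suc m) (λ a → - u a) + sumTo (suc m) (λ a → t m (suc a)))
      ≈⟨ +-congˡ (+-cong (sumTo-neg (suc m) u)
           (≈-trans (sumTo-suc m (λ a → t m (suc a))) (≈-trans (+-congˡ top-term-vanishes) (+-identityʳ _)))) ⟩
    t m 0 + (- sumTo (suc m) u + sumTo m (λ a → t m (suc a)))
      ≈⟨ +-Solver.solve 3 (λ a b c → a ⊕ (b ⊕ c) ⊜ (a ⊕ c) ⊕ b) ≈-refl _ _ _ ⟩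
    (t m 0 + sumTo m (λ a → t m (suc a))) - sumTo (suc m) u
      ≡⟨ cong₂ _-_ (sym (diffPow-sumTo m f n)) (sym (diffPow-sumTo m f (n ℤ.- 1ℤ))) ⟩
    diffPow m f n - diffPow m f (n ℤ.- 1ℤ) ∎
    where
    open +-Solver using (_⊕_; _⊜_)
    t : ℕ → ℕ → Carrier
    t k a = sign a * natR (k C a) * f (n ℤ.- + a)
    u : ℕ → Carrier
    u a = sign a * natR (m C a) * f (n ℤ.- 1ℤ ℤ.- + a)
    pascal-step : ∀ a → t (suc m) (suc a) ≈ - u a + t m (suc a)
    pascal-step a = begin
      - sign a * natR (suc m C suc a) * f (n ℤ.- + suc a)
        ≈⟨ *-congʳ (*-congˡ (natR-pascal m a)) ⟩
      - sign a * (natR (m C a) + natR (m C suc a)) * f (n ℤ.- + suc a)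
        ≈⟨ ≈-trans (*-congʳ (distribˡ _ _ _)) (distribʳ _ _ _) ⟩
      - sign a * natR (m C a) * f (n ℤ.- + suc a) + t m (suc a)
        ≈⟨ +-congʳ (≈-trans (*-congʳ (≈-sym (-‿distribˡ-* _ _))) (≈-sym (-‿distribˡ-* _ _))) ⟩
      - (sign a * natR (m C a) * f (n ℤ.- + suc a)) + t m (suc a)
        ≡⟨ cong (λ z → - (sign a * natR (m C a) * f z) + t m (suc a)) (n-[1+a]≡n-1-a n a) ⟩
      - u a + t m (suc a) ∎
    top-term-vanishes : t m (suc m) ≈ 0#
    top-term-vanishes = ≈-trans
      (*-congʳ (≈-trans (*-congˡ (reflexive (cong natR (k>n⇒nCk≡0 (ℕ.n<1+n m))))) (zeroʳ _))) (zeroˡ _)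

  diffPow-suc≈diffPow-diff : ∀ m f n → diffPow (suc m) f n ≈ diffPow m (diff f) n
  diffPow-suc≈diffPow-diff m f n = ≈-trans (diffPow-suc m f n) (≈-sym (diffPow-diff m f n))

  hmℕ-sumTo : ∀ m N → hmℕ m N ≡ sumTo (suc N) (λ j → natR ((m ℕ.+ j ∸ 1) C j) * hℕ (N ∸ j))
  hmℕ-sumTo m N = sumR-map-applyUpTo (suc N) _ (λ j → j)

  diff-hm : ∀ s n → diff (hm (suc s)) n ≈ hm s n
  diff-hm s -[1+ k ]  = x-0#≈x 0#
  diff-hm s (+ zero)  = x-0#≈x _
  diff-hm s (+ suc k) = begin
    hmℕ (suc s) (suc k) - hmℕ (suc s) k
      ≡⟨ cong₂ _-_ (hmℕ-sumTo (suc s) (suc k)) (hmℕ-sumTo (suc s) k) ⟩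
    A 0 + sumTo (suc k) (A ∘ suc) - H
      ≈⟨ +-congʳ (+-congˡ (≈-trans (sumTo-cong (suc k) pascal-step) (sumTo-+ (suc k) B (B′ ∘ suc)))) ⟩
    A 0 + (H + W) - H
      ≈⟨ +-Solver.solve 4 (λ a b c d → (a ⊕ (b ⊕ c)) ⊕ d ⊜ (a ⊕ c) ⊕ (b ⊕ d)) ≈-refl _ _ _ _ ⟩
    (A 0 + W) + (H - H)
      ≈⟨ ≈-trans (+-congˡ (-‿inverseʳ H)) (+-identityʳ _) ⟩
    A 0 + W
      ≡⟨ sym (hmℕ-sumTo s (suc k)) ⟩
    hmℕ s (suc k) ∎
    where
    open +-Solver using (_⊕_; _⊜_)
    A B B′ : ℕ → Carrier
    A j  = natR ((suc s ℕ.+ j ∸ 1) C j) * hℕ (suc k ∸ j)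
    B j  = natR ((suc s ℕ.+ j ∸ 1) C j) * hℕ (k ∸ j)
    B′ j = natR ((s ℕ.+ j ∸ 1) C j) * hℕ (suc k ∸ j)
    H = sumTo (suc k) B
    W = sumTo (suc k) (B′ ∘ suc)
    binomial-pascal : ∀ j → (s ℕ.+ suc j) C suc j ≡ (s ℕ.+ j) C j ℕ.+ (s ℕ.+ suc j ∸ 1) C suc j
    binomial-pascal j = trans (cong (_C suc j) (ℕ.+-suc s j))
      (trans (sym (nCk+nC[k+1]≡[n+1]C[k+1] (s ℕ.+ j) j))
             (cong (λ z → (s ℕ.+ j) C j ℕ.+ (z ∸ 1) C suc j) (sym (ℕ.+-suc s j))))
    pascal-step : ∀ j → A (suc j) ≈ B j + B′ (suc j)
    pascal-step j = ≈-trans (*-congʳ (≈-trans (reflexive (cong natR (binomial-pascal j)))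
                                              (natR-+ ((s ℕ.+ j) C j) ((s ℕ.+ suc j ∸ 1) C suc j))))
                            (distribʳ _ _ _)

  diffPow-hm : ∀ m s n → diffPow (suc m) (hm (suc s)) n ≈ diffPow m (hm s) n
  diffPow-hm m s n = ≈-trans (diffPow-suc≈diffPow-diff m (hm (suc s)) n) (diffPow-cong m (diff-hm s) n)

  prodFin-cong : ∀ {ℓ} {f g : Fin ℓ → Carrier} → (∀ i → f i ≈ g i) → prodFin f ≈ prodFin g
  prodFin-cong {zero}  f≈g = ≈-refl
  prodFin-cong {suc ℓ} f≈g = *-cong (f≈g Fin.zero) (prodFin-cong (f≈g ∘ Fin.suc))

  sumFin-cong : ∀ {ℓ} {a b : Fin ℓ → ℕ} → a ≗ b → sumFin a ≡ sumFin b
  sumFin-cong {zero}  a≗b = refl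
  sumFin-cong {suc ℓ} a≗b = cong₂ ℕ._+_ (a≗b Fin.zero) (sumFin-cong (a≗b ∘ Fin.suc))

  prodFinℕ-cong : ∀ {ℓ} {a b : Fin ℓ → ℕ} → a ≗ b → prodFinℕ a ≡ prodFinℕ b
  prodFinℕ-cong {zero}  a≗b = refl
  prodFinℕ-cong {suc ℓ} a≗b = cong₂ ℕ._*_ (a≗b Fin.zero) (prodFinℕ-cong (a≗b ∘ Fin.suc))

  boxTerm : ∀ {ℓ} (m : Fin ℓ → ℕ) (f : Fin ℓ → ℤ → Carrier) (v : Fin ℓ → ℤ) → (Fin ℓ → ℕ) → Carrier
  boxTerm m f v a = sign (sumFin a) * natR (prodFinℕ (λ j → m j C a j)) * prodFin (λ k → f k (v k ℤ.- + a k))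

  -- The local constructor of boxes is not in scope, so it is recovered together with its equations.
  boxes-suc : ∀ {ℓ} (m : Fin (suc ℓ) → ℕ) →
    Σ (ℕ → (Fin ℓ → ℕ) → Fin (suc ℓ) → ℕ) λ cons →
      (∀ a r → cons a r Fin.zero ≡ a) × (∀ a r k → cons a r (Fin.suc k) ≡ r k) ×
      (boxes m ≡ concatMap (λ a → map (cons a) (boxes (m ∘ Fin.suc))) (upTo (suc (m Fin.zero))))
  boxes-suc m = _ , (λ a r → refl) , (λ a r k → refl) , refl

  sum-boxes≈prodFin-diffPow : ∀ {ℓ} (m : Fin ℓ → ℕ) f v →
    sumR (map (boxTerm m f v) (boxes m)) ≈ prodFin (λ k → diffPow (m k) (f k) (v k))
  sum-boxes≈prodFin-diffPow {zero} m f v =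
    ≈-trans (+-identityʳ _) (≈-trans (*-identityʳ _) (≈-trans (*-identityˡ _) (+-identityʳ _)))
  sum-boxes≈prodFin-diffPow {suc ℓ} m f v with boxes-suc m
  ... | cons , cons-zero , cons-suc , boxes≡ = begin
    sumR (map (boxTerm m f v) (boxes m))
      ≡⟨ cong (λ bs → sumR (map (boxTerm m f v) bs)) boxes≡ ⟩
    sumR (map (boxTerm m f v) (concatMap (λ a → map (cons a) (boxes m′)) (upTo (suc (m Fin.zero)))))
      ≈⟨ sumR-map-concatMap (boxTerm m f v) (λ a → map (cons a) (boxes m′)) (upTo (suc (m Fin.zero))) ⟩
    sumR (map (λ a → sumR (map (boxTerm m f v) (map (cons a) (boxes m′)))) (upTo (suc (m Fin.zero))))
      ≈⟨ sumR-cong (upTo (suc (m Fin.zero))) (λ a → begin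
           sumR (map (boxTerm m f v) (map (cons a) (boxes m′)))
             ≡⟨ sumR-map-map (boxTerm m f v) (cons a) (boxes m′) ⟩
           sumR (map (boxTerm m f v ∘ cons a) (boxes m′))
             ≈⟨ sumR-cong (boxes m′) (boxTerm-cons a) ⟩
           sumR (map (λ r → first a * boxTerm m′ f′ v′ r) (boxes m′))
             ≈⟨ sumR-map-*ˡ (first a) (boxTerm m′ f′ v′) (boxes m′) ⟩
           first a * sumR (map (boxTerm m′ f′ v′) (boxes m′))
             ≈⟨ *-congˡ (sum-boxes≈prodFin-diffPow m′ f′ v′) ⟩
           first a * rest ∎) ⟩
    sumR (map (λ a → first a * rest) (upTo (suc (m Fin.zero))))
      ≈⟨ sumR-map-*ʳ rest first (upTo (suc (m Fin.zero))) ⟩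
    diffPow (m Fin.zero) (f Fin.zero) (v Fin.zero) * rest ∎
    where
    m′ = m ∘ Fin.suc
    f′ = f ∘ Fin.suc
    v′ = v ∘ Fin.suc
    first : ℕ → Carrier
    first a = sign a * natR (m Fin.zero C a) * f Fin.zero (v Fin.zero ℤ.- + a)
    rest : Carrier
    rest = prodFin (λ k → diffPow (m′ k) (f′ k) (v′ k))
    regroup : ∀ s₁ s₂ n₁ n₂ x y → (s₁ * s₂) * (n₁ * n₂) * (x * y) ≈ (s₁ * n₁ * x) * (s₂ * n₂ * y)
    regroup = *-Solver.solve 6
      (λ s₁ s₂ n₁ n₂ x y → ((s₁ ⊕ s₂) ⊕ (n₁ ⊕ n₂)) ⊕ (x ⊕ y) ⊜ ((s₁ ⊕ n₁) ⊕ x) ⊕ ((s₂ ⊕ n₂) ⊕ y)) ≈-refl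
      where open *-Solver
    boxTerm-cons : ∀ a r → boxTerm m f v (cons a r) ≈ first a * boxTerm m′ f′ v′ r
    boxTerm-cons a r = ≈-trans
      (*-cong (*-cong (reflexive (cong sign (sumFin-cong cons≗)))
                      (reflexive (cong natR (prodFinℕ-cong (λ j → cong (m j C_) (cons≗ j))))))
              (prodFin-cong (λ k → reflexive (cong (λ z → f k (v k ℤ.- + z)) (cons≗ k)))))
      (≈-trans (*-congʳ (*-cong (sign-+ a (sumFin r)) (natR-* (m Fin.zero C a) (prodFinℕ (λ j → m′ j C r j)))))
               (regroup _ _ _ _ _ _))
      where
      cons≗ : cons a r ≗ λ { Fin.zero → a ; (Fin.suc k) → r k }
      cons≗ Fin.zero    = cons-zero a r
      cons≗ (Fin.suc k) = cons-suc a r k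

  kLowered : ∀ {ℓ} → Multiset ℓ → (Fin ℓ → ℤ) → Carrier
  kLowered M v = prodFin (λ i → diffPow (M i) (hm (toℕ i)) (v i))

  kLowered-resp : ∀ {ℓ} (M : Multiset ℓ) → Respects≗ (kLowered M)
  kLowered-resp M u≗v = prodFin-cong (λ i → reflexive (cong (diffPow (M i) (hm (toℕ i))) (u≗v i)))

  K≈Φ-kLowered : ∀ {ℓ} (Ψ : RootSet ℓ) M γ → K Ψ M γ ≈ Φ (complementRoots Ψ) (kLowered M) γ
  K≈Φ-kLowered Ψ M γ = sumR-cong (subsets (complementRoots Ψ)) λ S → begin
    sumR (map (λ a → sign (length S ℕ.+ sumFin a) * natR (prodFinℕ (λ j → M j C a j))
                       * kfun (exponent γ S a)) (boxes M))
      ≈⟨ sumR-cong (boxes M) (λ a → ≈-trans (*-congʳ (*-congʳ (sign-+ (length S) (sumFin a)))) (reassoc _ _ _ _)) ⟩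
    sumR (map (λ a → sign (length S) * boxTerm M (hm ∘ toℕ) (addRoots γ S) a) (boxes M))
      ≈⟨ sumR-map-*ˡ (sign (length S)) _ (boxes M) ⟩
    sign (length S) * sumR (map (boxTerm M (hm ∘ toℕ) (addRoots γ S)) (boxes M))
      ≈⟨ *-congˡ (sum-boxes≈prodFin-diffPow M (hm ∘ toℕ) (addRoots γ S)) ⟩
    sign (length S) * kLowered M (addRoots γ S) ∎
    where
    reassoc : ∀ s₁ s₂ n k → (s₁ * s₂) * n * k ≈ s₁ * (s₂ * n * k)
    reassoc = *-Solver.solve 4 (λ s₁ s₂ n k → ((s₁ ⊕ s₂) ⊕ n) ⊕ k ⊜ s₁ ⊕ ((s₂ ⊕ n) ⊕ k)) ≈-refl
      where open *-Solver

  prodFin-linearAt : ∀ {ℓ} (r : Fin ℓ) {X Y Z : Fin ℓ → Carrier} →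
    (∀ {i} → i ≢ r → X i ≈ Y i) → (∀ {i} → i ≢ r → X i ≈ Z i) → X r ≈ Y r - Z r →
    prodFin X ≈ prodFin Y - prodFin Z
  prodFin-linearAt {suc ℓ} Fin.zero {X} {Y} {Z} X≈Y X≈Z Xr≈ = begin
    X Fin.zero * prodFin (X ∘ Fin.suc)                          ≈⟨ *-congʳ Xr≈ ⟩
    (Y Fin.zero - Z Fin.zero) * prodFin (X ∘ Fin.suc)            ≈⟨ [y-z]x≈yx-zx _ _ _ ⟩
    Y Fin.zero * prodFin (X ∘ Fin.suc) - Z Fin.zero * prodFin (X ∘ Fin.suc)
      ≈⟨ +-cong (*-congˡ (prodFin-cong (λ i → X≈Y {Fin.suc i} (λ ()))))
                (-‿cong (*-congˡ (prodFin-cong (λ i → X≈Z {Fin.suc i} (λ ()))))) ⟩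
    prodFin Y - prodFin Z ∎
  prodFin-linearAt {suc ℓ} (Fin.suc r) {X} {Y} {Z} X≈Y X≈Z Xr≈ = begin
    X Fin.zero * prodFin (X ∘ Fin.suc)
      ≈⟨ *-congˡ (prodFin-linearAt r (λ i≢r → X≈Y (i≢r ∘ Fin.suc-injective))
                                     (λ i≢r → X≈Z (i≢r ∘ Fin.suc-injective)) Xr≈) ⟩
    X Fin.zero * (prodFin (Y ∘ Fin.suc) - prodFin (Z ∘ Fin.suc))
      ≈⟨ x[y-z]≈xy-xz _ _ _ ⟩
    X Fin.zero * prodFin (Y ∘ Fin.suc) - X Fin.zero * prodFin (Z ∘ Fin.suc)
      ≈⟨ +-cong (*-congʳ (X≈Y (λ ()))) (-‿cong (*-congʳ (X≈Z (λ ())))) ⟩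
    prodFin Y - prodFin Z ∎

  kLowered-addElem : ∀ {ℓ} (M : Multiset ℓ) r v →
    kLowered (addElem M r) v ≈ kLowered M v - kLowered M (lowerAt v r)
  kLowered-addElem M r v = prodFin-linearAt r
    (λ {i} i≢r → reflexive (cong (λ m → diffPow m (hm (toℕ i)) (v i)) (addElem-other M i≢r)))
    (λ {i} i≢r → reflexive (cong₂ (λ m n → diffPow m (hm (toℕ i)) n) (addElem-other M i≢r)
                                                               (sym (shiftAt-other v -1ℤ i≢r))))
    (begin
      diffPow (addElem M r r) hr (v r)        ≡⟨ cong (λ m → diffPow m hr (v r)) (addElem-self M r) ⟩
      diffPow (suc (M r)) hr (v r)            ≈⟨ diffPow-suc (M r) hr (v r) ⟩
      diffPow (M r) hr (v r) - diffPow (M r) hr (v r ℤ.- 1ℤ)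
        ≡⟨ cong (λ n → diffPow (M r) hr (v r) - diffPow (M r) hr n) (sym (shiftAt-self v r -1ℤ)) ⟩
      diffPow (M r) hr (v r) - diffPow (M r) hr (lowerAt v r r) ∎)
    where hr = hm (toℕ r)

  prodFin≡∏ : ∀ {ℓ} (f : Fin ℓ → Carrier) → prodFin f ≡ ∏.sum f
  prodFin≡∏ {zero}  f = refl
  prodFin≡∏ {suc ℓ} f = cong (f Fin.zero *_) (prodFin≡∏ (f ∘ Fin.suc))

  kLowered-swap-invariant : ∀ {ℓ} (M : Multiset ℓ) (i j : Fin ℓ) →
    (∀ n → diffPow (M i) (hm (toℕ i)) n ≈ diffPow (M j) (hm (toℕ j)) n) →
    ∀ v → kLowered M (v ∘ Transposition.τ i j) ≈ kLowered M v
  kLowered-swap-invariant M i j factors-equal v = begin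
    prodFin (λ k → factor k (v (τ k)))     ≈⟨ prodFin-cong (λ k → factor-swap k (v (τ k))) ⟩
    prodFin (λ k → factor (τ k) (v (τ k))) ≡⟨ prodFin≡∏ (λ k → factor (τ k) (v (τ k))) ⟩
    ∏.sum (λ k → factor (τ k) (v (τ k)))   ≈⟨ ∏.sum-permute (λ k → factor k (v k)) (Perm.transpose i j) ⟨
    ∏.sum (λ k → factor k (v k))           ≡⟨ prodFin≡∏ (λ k → factor k (v k)) ⟨
    prodFin (λ k → factor k (v k))         ∎
    where
    open Transposition i j
    factor : Fin _ → ℤ → Carrier
    factor k = diffPow (M k) (hm (toℕ k))
    factor-swap : ∀ k n → factor k n ≈ factor (τ k) n
    factor-swap k n = by-cases (k ≟ i) (k ≟ j)
      where
      by-cases : Dec (k ≡ i) → Dec (k ≡ j) → factor k n ≈ factor (τ k) n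
      by-cases (yes refl) _ = ≈-trans (factors-equal n) (reflexive (cong (λ x → factor x n) (sym τ-i)))
      by-cases (no _) (yes refl) =
        ≈-trans (≈-sym (factors-equal n)) (reflexive (cong (λ x → factor x n) (sym τ-j)))
      by-cases (no k≢i) (no k≢j) = reflexive (cong (λ x → factor x n) (sym (τ-other k≢i k≢j)))

  module Straightening {ℓ} (Ψ : RootSet ℓ) (Ψ-ideal : IsRootIdeal Ψ) (M : Multiset ℓ) {p p₁ q : Fin ℓ}
    (p≡p₁+1 : toℕ p ≡ suc (toℕ p₁)) (edge : BounceEdge Ψ p q) (β-addable : Addable Ψ (q , p₁))
    (M-p : M p ≡ suc (M p₁)) (wall : Wall Ψ p₁ p) where

    open BounceConfiguration Ψ Ψ-ideal p≡p₁+1 edge β-addable wall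
    open Transposition p₁ p
    open StraighteningVectors p₁≢p q≢p₁ q≢p

    F : (Fin ℓ → ℤ) → Carrier
    F = kLowered M

    F-resp : Respects≗ F
    F-resp = kLowered-resp M

    F-swap-invariant : ∀ v → F (v ∘ τ) ≈ F v
    F-swap-invariant = kLowered-swap-invariant M p₁ p factors-equal
      where
      factors-equal : ∀ n → diffPow (M p₁) (hm (toℕ p₁)) n ≈ diffPow (M p) (hm (toℕ p)) n
      factors-equal n rewrite M-p | p≡p₁+1 = ≈-sym (diffPow-hm (M p₁) (toℕ p₁) n)

    ΦRest-swap-invariant : ∀ v → Φ Rest F v ≈ Φ Rest F (v ∘ τ)
    ΦRest-swap-invariant v = begin
      Φ Rest F v                           ≈⟨ Φ-resp Rest F-resp (cong v ∘ sym ∘ τ-involutive) ⟩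
      Φ Rest F ((v ∘ τ) ∘ τ)               ≈⟨ Φ-↭ F-resp Rest-swap-invariant _ ⟨
      Φ (map τRoot Rest) F ((v ∘ τ) ∘ τ)   ≈⟨ Φ-swap p₁ p Rest F-resp F-swap-invariant (v ∘ τ) ⟩
      Φ Rest F (v ∘ τ)                     ∎

    Φ′-expand : ∀ v → Φ (complementRoots Ψ′) F v ≈ Φ Rest F v - Φ Rest F (addRoot v (p₁ , p))
    Φ′-expand v = ≈-trans (Φ-↭ F-resp complementRoots′-split v) (Φ-∷ (p₁ , p) Rest F-resp v)

    Φ′-vanishes : ∀ v → v p ≡ v p₁ +ℤ 1ℤ → Φ (complementRoots Ψ′) F v ≈ 0#
    Φ′-vanishes v straight = begin
      Φ (complementRoots Ψ′) F v               ≈⟨ Φ′-expand v ⟩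
      Φ Rest F v - Φ Rest F (addRoot v (p₁ , p))
        ≈⟨ +-congˡ (-‿cong (Φ-resp Rest F-resp (addRoot-straight v straight))) ⟩
      Φ Rest F v - Φ Rest F (v ∘ τ)                  ≈⟨ +-congˡ (-‿cong (ΦRest-swap-invariant v)) ⟨
      Φ Rest F v - Φ Rest F v                        ≈⟨ -‿inverseʳ _ ⟩
      0#                                       ∎

    module _ (γ : Fin ℓ → ℤ) (γ-p : γ p ≡ γ p₁ +ℤ 1ℤ) where

      γ′ : Fin ℓ → ℤ
      γ′ = addRoot γ (q , p)

      K-raise-β : K Ψ M γ ≈ K Ψ′ M γ′
      K-raise-β = begin
        K Ψ M γ                                       ≈⟨ K≈Φ-kLowered Ψ M γ ⟩
        Φ (complementRoots Ψ) F γ                     ≈⟨ Φ-↭ F-resp complementRoots-split-β γ ⟩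
        Φ ((q , p₁) ∷ complementRoots Ψ′) F γ          ≈⟨ Φ-∷ (q , p₁) (complementRoots Ψ′) F-resp γ ⟩
        Φ (complementRoots Ψ′) F γ - Φ (complementRoots Ψ′) F δ
          ≈⟨ +-cong (Φ′-vanishes γ γ-p) (-‿cong (Φ′-expand δ)) ⟩
        0# - (Φ Rest F δ - Φ Rest F (addRoot δ (p₁ , p)))
          ≈⟨ ≈-trans (+-identityˡ _) (⁻¹-anti-homo‿- _ _) ⟩
        Φ Rest F (addRoot δ (p₁ , p)) - Φ Rest F δ
          ≈⟨ +-cong (Φ-resp Rest F-resp (addRoot-chain γ))
                    (-‿cong (≈-trans (ΦRest-swap-invariant δ)
                                     (Φ-resp Rest F-resp (sym ∘ addRoot-chain-straight γ γ-p)))) ⟩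
        Φ Rest F γ′ - Φ Rest F (addRoot γ′ (p₁ , p))          ≈⟨ Φ′-expand γ′ ⟨
        Φ (complementRoots Ψ′) F γ′                    ≈⟨ K≈Φ-kLowered Ψ′ M γ′ ⟨
        K Ψ′ M γ′                                      ∎
        where
        δ = addRoot γ (q , p₁)

      K-addElem : K Ψ′ M γ′ ≈ K Ψ′ (addElem M p₁) γ′
      K-addElem = begin
        K Ψ′ M γ′                                                        ≈⟨ K≈Φ-kLowered Ψ′ M γ′ ⟩
        Φ (complementRoots Ψ′) F γ′                                      ≈⟨ x-0#≈x _ ⟨
        Φ (complementRoots Ψ′) F γ′ - 0#
          ≈⟨ +-congˡ (-‿cong (Φ′-vanishes (lowerAt γ′ p₁) (straight-after-lowering γ γ-p))) ⟨
        Φ (complementRoots Ψ′) F γ′ - Φ (complementRoots Ψ′) F (lowerAt γ′ p₁)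
          ≈⟨ Φ-lowering (complementRoots Ψ′) p₁ F-resp (kLowered-addElem M p₁) γ′ ⟨
        Φ (complementRoots Ψ′) (kLowered (addElem M p₁)) γ′               ≈⟨ K≈Φ-kLowered Ψ′ (addElem M p₁) γ′ ⟨
        K Ψ′ (addElem M p₁) γ′                                           ∎

lemma3p24 : ∀ {c ℓr : Level} (R : CommutativeRing c ℓr)
    (h : ℕ → CommutativeRing.Carrier R)
    (ℓ : ℕ) → 2 ≤ ℓ →
    (Ψ : RootSet ℓ) → IsRootIdeal Ψ →
    (M : Multiset ℓ) (γ : Fin ℓ → ℤ)
    (p p₁ q : Fin ℓ) → toℕ p ≡ suc (toℕ p₁) →
    BounceEdge Ψ p q →
    Addable Ψ (q , p₁) →
    γ p ≡ γ p₁ +ℤ + 1 →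
    M p ≡ suc (M p₁) →
    Wall Ψ p₁ p →
    let open CommutativeRing R using (_≈_)
        K = Katalan.K R h
        γ′ = addRoot γ (q , p)
        Ψ′ = insertR Ψ (q , p₁)
    in (K Ψ M γ ≈ K Ψ′ M γ′) × (K Ψ′ M γ′ ≈ K Ψ′ (addElem M p₁) γ′)
-- The hypothesis 2 ≤ ℓ is implied by p₁ < p.
lemma3p24 R h ℓ _ Ψ Ψ-ideal M γ p p₁ q p≡p₁+1 edge β-addable γ-p M-p wall =
  K-raise-β γ γ-p , K-addElem γ γ-p
  where open KatalanExpansion.Straightening R h Ψ Ψ-ideal M p≡p₁+1 edge β-addable M-p wall
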